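{- Let $C_1,C_2$ be sets of components with the alphabet $\Sigma$ partitioned into $\Sigma_{12},\Sigma_1,\Sigma_2$ as described, and let $\mathcal{P}_1\subseteq\Sigma\times\Sigma_1$ and $\mathcal{P}_2\subseteq\Sigma\times\Sigma_2$. Let $\mathcal{S}_1=(C_1\cup\{d_1\},\Sigma,\mathcal{P}_1)$, $\mathcal{S}_2=(C_2\cup\{d_2\},\Sigma,\mathcal{P}_2)$ and $\mathcal{S}_{1+2}=(C_1\cup C_2,\Sigma,\mathcal{P}_1\cup\mathcal{P}_2)$. Then $\mathcal{L}(\mathcal{S}_{1+2})\subseteq\mathcal{L}(\mathcal{S}_1)\cap\mathcal{L}(\mathcal{S}_2)$.
   Context: A system is a tuple $\mathcal{S}=(C,\Sigma,\mathcal{P})$ where $\Sigma$ is a finite set of interaction labels; $C$ is a finite set of components, each $C_i=(L_i,V_i,\Sigma_i',T_i,l_i^0,e_i^0)$ with $L_i$ a finite set of locations, $V_i$ a finite set of Boolean variables, $\Sigma_i'\subseteq\Sigma$ its alphabet, $T_i$ a set of transitions $(l,g,\sigma,f,l')$ with $l,l'\in L_i$, guard $g$ a Boolean formula over $V_i$, $\sigma\in\Sigma_i'$, and update $f$ mapping each $v\in V_i$ to a Boolean formula over $V_i$; $l_i^0$ is the initial location and $e_i^0$ the initial evaluation. $\mathcal{P}\subseteq\Sigma\times\Sigma$ is a priority relation. A configuration assigns each component a location and evaluation; the initial configuration $c^0$ uses the initial ones. $\sigma$ satisfies joint participation in configuration $c$ if every component whose alphabet contains $\sigma$ has a transition labelled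 $\sigma$ from its current location with guard true under its current evaluation; $\sigma$ is enabled if it satisfies joint participation and there is no $\bar\sigma$ satisfying joint participation with $(\sigma,\bar\sigma)\in\mathcal{P}$. If $\sigma$ is enabled in $c$, $c\xrightarrow{\sigma}c'$ when each component whose alphabet contains $\sigma$ takes such a transition $(l,g,\sigma,f,l')$ (new location $l'$, new evaluation $e'(v)=f(v)(e)$) and all other components are unchanged. The language $\mathcal{L}(\mathcal{S})$ is the set of words $\sigma_1\cdots\sigma_k\in\Sigma^*$ such that there are configurations $c^0\xrightarrow{\sigma_1}c_1\cdots\xrightarrow{\sigma_k}c_k$. Decomposition: $\Sigma$ is partitioned into $\Sigma_{12}$ (interactions appearing in components of both $C_1$ and $C_2$), $\Sigma_1$ (interactions appearing only in components of $C_1$) and $\Sigma_2$ (interactions appearing only in components of $C_2$). For $i=1,2$, $d_i$ is a component with a single location, no variables, and, for each $\sigma\in\Sigma_{3-i}$, a self-loop transition labelled $\sigma$ with guard true. -}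

module Defs where

open import Data.Nat using (ℕ; zero; suc; _+_)
open import Data.Fin using (Fin; zero; suc)
open import Data.Bool using (Bool; true; false; not; _∧_; _∨_)
open import Data.Vec using (Vec; lookup; tabulate)
open import Data.List using (List; []; _∷_; allFin)
open import Data.List.Membership.Propositional using (_∈_)
open import Data.List.Relation.Unary.All using (All; []; _∷_)
open import Data.Product using (Σ; _×_; _,_; ∃; ∃-syntax)
open import Data.Sum using (_⊎_)
import Data.Vec
open import Relation.Nullary using (¬_)
open import Relation.Binary.PropositionalEquality using (_≡_; refl)
import Data.Vec.Functional as VF

data Formula (m : ℕ) : Set where
  tt ff : Formula m
  var   : Fin m → Formula m
  ¬'_   : Formula m → Formula m
  _∧'_ _∨'_ : Formula m → Formula m → Formula m

Eval : ℕ → Set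
Eval m = Vec Bool m

⟦_⟧ : ∀ {m} → Formula m → Eval m → Bool
⟦ tt ⟧ e = true
⟦ ff ⟧ e = false
⟦ var v ⟧ e = lookup e v
⟦ ¬' φ ⟧ e = not (⟦ φ ⟧ e)
⟦ φ ∧' ψ ⟧ e = ⟦ φ ⟧ e ∧ ⟦ ψ ⟧ e
⟦ φ ∨' ψ ⟧ e = ⟦ φ ⟧ e ∨ ⟦ ψ ⟧ e

record Transition (n nL nV : ℕ) : Set where
  constructor trans
  field
    src    : Fin nL
    guard  : Formula nV
    label  : Fin n
    update : Fin nV → Formula nV
    tgt    : Fin nL

applyUpd : ∀ {m} → (Fin m → Formula m) → Eval m → Eval m
applyUpd f e = tabulate (λ v → ⟦ f v ⟧ e)

record Component (n : ℕ) : Set where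
  field
    nL nV : ℕ
    alph  : Fin n → Bool
    trs   : List (Transition n nL nV)
    l0    : Fin nL
    e0    : Eval nV
    trs-alph : All (λ t → alph (Transition.label t) ≡ true) trs
open Component public

record System (n : ℕ) : Set₁ where
  field
    k     : ℕ
    comps : Fin k → Component n
    prio  : Fin n → Fin n → Set
open System public

State : ∀ {n} → Component n → Set
State C = Fin (nL C) × Eval (nV C)

Config : ∀ {n} → System n → Set
Config S = (i : Fin (k S)) → State (comps S i)

initConfig : ∀ {n} (S : System n) → Config S
initConfig S i = l0 (comps S i) , e0 (comps S i)

Firable : ∀ {n} (C : Component n) → State C → Fin n → Transition n (nL C) (nV C) → Set
Firable C (l , e) σ t =
  t ∈ trs C × Transition.src t ≡ l × Transition.label t ≡ σ × ⟦ Transition.guard t ⟧ e ≡ true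

JointParticipation : ∀ {n} (S : System n) → Config S → Fin n → Set
JointParticipation S c σ =
  ∀ i → alph (comps S i) σ ≡ true → ∃[ t ] Firable (comps S i) (c i) σ t

Enabled : ∀ {n} (S : System n) → Config S → Fin n → Set
Enabled S c σ =
  JointParticipation S c σ × (∀ σ' → prio S σ σ' → ¬ JointParticipation S c σ')

Step : ∀ {n} (S : System n) → Config S → Fin n → Config S → Set
Step S c σ c' =
  Enabled S c σ ×
  (∀ i → (alph (comps S i) σ ≡ true →
            ∃[ t ] (Firable (comps S i) (c i) σ t ×
                    c' i ≡ (Transition.tgt t , applyUpd (Transition.update t) (proj₂' (c i)))))
       × (alph (comps S i) σ ≡ false → c' i ≡ c i))
  where
  proj₂' : ∀ {A B : Set} → A × B → B
  proj₂' (_ , b) = b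

data Steps {n} (S : System n) : Config S → List (Fin n) → Config S → Set where
  done : ∀ {c} → Steps S c [] c
  step : ∀ {c c' c'' σ w} → Step S c σ c' → Steps S c' w c'' → Steps S c (σ ∷ w) c''

Lang : ∀ {n} → System n → List (Fin n) → Set
Lang S w = ∃[ c ] Steps S (initConfig S) w c

anyFin : ∀ {k} → (Fin k → Bool) → Bool
anyFin {zero} p = false
anyFin {suc k} p = p zero ∨ anyFin (λ i → p (suc i))

appears : ∀ {n k} → (Fin k → Component n) → Fin n → Bool
appears C σ = anyFin (λ i → alph (C i) σ)

module Decomposition {n k₁ k₂ : ℕ} (C₁ : Fin k₁ → Component n) (C₂ : Fin k₂ → Component n) where

  inΣ₁₂ inΣ₁ inΣ₂ : Fin n → Bool
  inΣ₁₂ σ = appears C₁ σ ∧ appears C₂ σ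
  inΣ₁  σ = appears C₁ σ ∧ not (appears C₂ σ)
  inΣ₂  σ = not (appears C₁ σ) ∧ appears C₂ σ

  loops : (p : Fin n → Bool) → List (Fin n) → List (Transition n 1 0)
  loops p [] = []
  loops p (σ ∷ σs) with p σ
  ... | true  = trans zero tt σ (λ ()) zero ∷ loops p σs
  ... | false = loops p σs

  loops-alph : (p : Fin n → Bool) (σs : List (Fin n)) →
               All (λ t → p (Transition.label t) ≡ true) (loops p σs)
  loops-alph p [] = []
  loops-alph p (σ ∷ σs) with p σ in eq
  ... | true  = eq ∷ loops-alph p σs
  ... | false = loops-alph p σs

  dummy : (Fin n → Bool) → Component n
  dummy p = record
    { nL = 1 ; nV = 0 ; alph = p
    ; trs = loops p (allFin n)
    ; l0 = zero ; e0 = Data.Vec.[]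
    ; trs-alph = loops-alph p (allFin n) }

  d₁ d₂ : Component n
  d₁ = dummy inΣ₂
  d₂ = dummy inΣ₁

  S₁ : (Fin n → Fin n → Set) → System n
  S₁ P₁ = record { k = suc k₁ ; comps = d₁ VF.∷ C₁ ; prio = P₁ }

  S₂ : (Fin n → Fin n → Set) → System n
  S₂ P₂ = record { k = suc k₂ ; comps = d₂ VF.∷ C₂ ; prio = P₂ }

  S₁₊₂ : (Fin n → Fin n → Set) → (Fin n → Fin n → Set) → System n
  S₁₊₂ P₁ P₂ = record { k = k₁ + k₂ ; comps = C₁ VF.++ C₂
                      ; prio = λ σ σ' → P₁ σ σ' ⊎ P₂ σ σ' }

module Submission where

-- A run of the composed system S₁₊₂ is turned into runs of S₁
-- and of S₂ by forgetting the components of the other half.  Both facts are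
-- instances of one general projection theorem:
--
--   if every component of a system T is either a copy of a component of S
--   or a "stuttering" component (one that can always move without changing
--   its state), every priority of T is a priority of S, and every component
--   of S that takes part in a label of higher T-priority is copied into T,
--   then L(S) ⊆ L(T).

open import Defs
open import Data.Nat using (ℕ; suc; _+_)
open import Data.Fin using (Fin; zero; suc; splitAt; _↑ˡ_; _↑ʳ_)
open import Data.Fin.Properties using (splitAt-↑ˡ; splitAt-↑ʳ; splitAt⁻¹-↑ˡ; splitAt⁻¹-↑ʳ)
open import Data.Bool using (Bool; true; false; not; _∧_; _∨_)
open import Data.Bool.Properties using (∨-zeroʳ)
open import Data.List using (List; _∷_; allFin)
open import Data.List.Membership.Propositional using (_∈_)
open import Data.List.Membership.Propositional.Properties using (∈-allFin)
open import Data.List.Relation.Unary.Any using (here; there)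
open import Data.Maybe using (Maybe; just; nothing)
open import Data.Product using (Σ; _×_; _,_; proj₁; proj₂; ∃-syntax)
open import Data.Sum using (inj₁; inj₂; [_,_]′)
open import Data.Empty using (⊥-elim)
open import Relation.Nullary using (¬_)
open import Relation.Binary.PropositionalEquality using (_≡_; refl; sym; cong; subst)
import Data.Vec

private
  variable
    n : ℕ

-- A component together with one of its states.  Stating local facts about
-- such pairs lets us move them between equal components without transport
-- along the component.
Local : ℕ → Set
Local n = Σ (Component n) State

⟨_,_⟩ : (C : Component n) → State C → Local n
⟨ C , s ⟩ = C , s

Participates : Fin n → Local n → Set
Participates σ (C , s) = alph C σ ≡ true → ∃[ t ] Firable C s σ t

Moves : (C : Component n) → Fin n → State C → State C → Set
Moves C σ s s' =
  (alph C σ ≡ true →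
     ∃[ t ] (Firable C s σ t ×
             s' ≡ (Transition.tgt t , applyUpd (Transition.update t) (proj₂ s))))
  × (alph C σ ≡ false → s' ≡ s)

moves⇒participates : {C : Component n} {σ : Fin n} {s s' : State C} →
                     Moves C σ s s' → Participates σ (C , s)
moves⇒participates (fire , _) inAlph with fire inAlph
... | t , firable , _ = t , firable

replayMove : {C C' : Component n} {σ : Fin n} {s : State C} {s' s'' : State C'} →
             ⟨ C , s ⟩ ≡ ⟨ C' , s' ⟩ → Moves C' σ s' s'' →
             ∃[ r ] (Moves C σ s r × ⟨ C , r ⟩ ≡ ⟨ C' , s'' ⟩)
replayMove refl move = _ , move , refl

-- A stuttering component can always move on any label without changing
-- its state, so it never restricts the behaviour of a system.
Stuttering : Component n → Set
Stuttering C = ∀ σ s → Moves C σ s s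

module _ {S T : System n} (R : Config S → Config T → Set)
         (init : R (initConfig S) (initConfig T))
         (match : ∀ {c c' d σ} → R c d → Step S c σ c' →
                  ∃[ d' ] (Step T d σ d' × R c' d')) where

  simulateSteps : ∀ {c c'' d w} → R c d → Steps S c w c'' → ∃[ d'' ] Steps T d w d''
  simulateSteps {d = d} related done = d , done
  simulateSteps related (step s steps) with match related s
  ... | d' , s' , related' with simulateSteps related' steps
  ...   | d'' , steps' = d'' , step s' steps'

  simulation : ∀ w → Lang S w → Lang T w
  simulation w (_ , steps) = simulateSteps init steps

record Projection (S T : System n) : Set₁ where
  field
    origin  : Fin (k T) → Maybe (Fin (k S))
    copy    : ∀ {j i} → origin j ≡ just i → comps T j ≡ comps S i
    stutter : ∀ {j} → origin j ≡ nothing → Stuttering (comps T j)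
    prio⊆   : ∀ {σ σ'} → prio T σ σ' → prio S σ σ'
    covered : ∀ {σ σ'} → prio T σ σ' →
              ∀ i → alph (comps S i) σ' ≡ true → ∃[ j ] origin j ≡ just i

module _ {S T : System n} (P : Projection S T) where
  open Projection P

  Agree : Config S → Config T → Set
  Agree c d = ∀ j i → origin j ≡ just i → ⟨ comps T j , d j ⟩ ≡ ⟨ comps S i , c i ⟩

  agreeInit : Agree (initConfig S) (initConfig T)
  agreeInit j i isCopy = cong (λ C → ⟨ C , (l0 C , e0 C) ⟩) (copy isCopy)

  followStep : ∀ {c c' d σ} → Agree c d → Step S c σ c' → ∀ j →
               ∃[ s ] (Moves (comps T j) σ (d j) s ×
                       (∀ {i} → origin j ≡ just i → ⟨ comps T j , s ⟩ ≡ ⟨ comps S i , c' i ⟩))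
  followStep agree (_ , moves) j with origin j in isOrigin
  ... | just i with replayMove (agree j i isOrigin) (moves i)
  ...   | s , move , agreeAfter = s , move , λ { refl → agreeAfter }
  followStep {d = d} {σ} agree (_ , moves) j | nothing = d j , stutter isOrigin σ (d j) , λ ()

  -- A label blocking σ in T would, through the copies, block σ in S.
  stillMaximal : ∀ {c d σ σ'} → Agree c d → Enabled S c σ → prio T σ σ' →
                 ¬ JointParticipation T d σ'
  stillMaximal {σ' = σ'} agree (_ , maximal) higher jpT =
    maximal σ' (prio⊆ higher) λ i inAlph →
      let (j , isCopy) = covered higher i inAlph
      in subst (Participates σ') (agree j i isCopy) (jpT j) inAlph

  matchStep : ∀ {c c' d σ} → Agree c d → Step S c σ c' →
              ∃[ d' ] (Step T d σ d' × Agree c' d')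
  matchStep {c' = c'} {d} {σ} agree st@(enabled , _) = d' , (enabledT , moves) , agree'
    where
    d' : Config T
    d' j = proj₁ (followStep agree st j)

    moves : ∀ j → Moves (comps T j) σ (d j) (d' j)
    moves j = proj₁ (proj₂ (followStep agree st j))

    enabledT : Enabled T d σ
    enabledT = (λ j → moves⇒participates {C = comps T j} (moves j))
             , λ σ' → stillMaximal agree enabled

    agree' : Agree c' d'
    agree' j i isCopy = proj₂ (proj₂ (followStep agree st j)) isCopy

  projection : ∀ w → Lang S w → Lang T w
  projection = simulation Agree agreeInit matchStep

anyFin-intro : ∀ {k} (p : Fin k → Bool) (i : Fin k) → p i ≡ true → anyFin p ≡ true
anyFin-intro p zero pi rewrite pi = refl
anyFin-intro p (suc i) pi
  rewrite anyFin-intro (λ j → p (suc j)) i pi = ∨-zeroʳ (p zero)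

left-only : ∀ a b → a ∧ not b ≡ true → ¬ (b ≡ true)
left-only true  true  () _
left-only false _     () _

right-only : ∀ a b → not a ∧ b ≡ true → ¬ (a ≡ true)
right-only true  _ () _

module Halves {k₁ k₂ : ℕ} (C₁ : Fin k₁ → Component n) (C₂ : Fin k₂ → Component n) where
  open Decomposition C₁ C₂

  loops-∈ : ∀ (p : Fin n → Bool) {σ} σs → p σ ≡ true → σ ∈ σs →
            ∃[ f ] trans zero tt σ f zero ∈ loops p σs
  loops-∈ p (σ ∷ σs) pσ (here refl) with p σ
  ... | true = _ , here refl
  loops-∈ p (σ' ∷ σs) pσ (there σ∈σs) with p σ'
  ... | true  = let (f , loop∈) = loops-∈ p σs pσ σ∈σs in f , there loop∈
  ... | false = loops-∈ p σs pσ σ∈σs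

  -- The dummy components have a single state and a self-loop on each label
  -- of their alphabet, hence they stutter.
  dummy-stutters : ∀ p → Stuttering (dummy p)
  dummy-stutters p σ (zero , Data.Vec.[]) = fire , λ _ → refl
    where
    fire : p σ ≡ true →
           ∃[ t ] (Firable (dummy p) (zero , Data.Vec.[]) σ t ×
                   (zero , Data.Vec.[]) ≡ (Transition.tgt t , applyUpd (Transition.update t) Data.Vec.[]))
    fire pσ with loops-∈ p (allFin n) pσ (∈-allFin σ)
    ... | f , loop∈ = trans zero tt σ f zero , (loop∈ , refl , refl , refl) , refl

  module _ (P₁ P₂ : Fin n → Fin n → Set) where

    projection₁ : (∀ σ σ' → P₁ σ σ' → inΣ₁ σ' ≡ true) → Projection (S₁₊₂ P₁ P₂) (S₁ P₁)
    projection₁ higher∈Σ₁ = record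
      { origin = origin ; copy = copy ; stutter = stutter ; prio⊆ = inj₁ ; covered = covered }
      where
      origin : Fin (suc k₁) → Maybe (Fin (k₁ + k₂))
      origin zero    = nothing
      origin (suc j) = just (j ↑ˡ k₂)

      copy : ∀ {j i} → origin j ≡ just i → comps (S₁ P₁) j ≡ comps (S₁₊₂ P₁ P₂) i
      copy {suc j} refl = cong [ C₁ , C₂ ]′ (sym (splitAt-↑ˡ k₁ j k₂))

      stutter : ∀ {j} → origin j ≡ nothing → Stuttering (comps (S₁ P₁) j)
      stutter {zero} refl = dummy-stutters inΣ₂

      covered : ∀ {σ σ'} → P₁ σ σ' → ∀ i → alph (comps (S₁₊₂ P₁ P₂) i) σ' ≡ true →
                ∃[ j ] origin j ≡ just i
      covered {σ} {σ'} higher i inAlph with splitAt k₁ i in split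
      ... | inj₁ j = suc j , cong just (splitAt⁻¹-↑ˡ split)
      ... | inj₂ j = ⊥-elim (left-only (appears C₁ σ') (appears C₂ σ') (higher∈Σ₁ σ σ' higher)
                               (anyFin-intro (λ i → alph (C₂ i) σ') j inAlph))

    projection₂ : (∀ σ σ' → P₂ σ σ' → inΣ₂ σ' ≡ true) → Projection (S₁₊₂ P₁ P₂) (S₂ P₂)
    projection₂ higher∈Σ₂ = record
      { origin = origin ; copy = copy ; stutter = stutter ; prio⊆ = inj₂ ; covered = covered }
      where
      origin : Fin (suc k₂) → Maybe (Fin (k₁ + k₂))
      origin zero    = nothing
      origin (suc j) = just (k₁ ↑ʳ j)

      copy : ∀ {j i} → origin j ≡ just i → comps (S₂ P₂) j ≡ comps (S₁₊₂ P₁ P₂) i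
      copy {suc j} refl = cong [ C₁ , C₂ ]′ (sym (splitAt-↑ʳ k₁ k₂ j))

      stutter : ∀ {j} → origin j ≡ nothing → Stuttering (comps (S₂ P₂) j)
      stutter {zero} refl = dummy-stutters inΣ₁

      covered : ∀ {σ σ'} → P₂ σ σ' → ∀ i → alph (comps (S₁₊₂ P₁ P₂) i) σ' ≡ true →
                ∃[ j ] origin j ≡ just i
      covered {σ} {σ'} higher i inAlph with splitAt k₁ i in split
      ... | inj₂ j = suc j , cong just (splitAt⁻¹-↑ʳ split)
      ... | inj₁ j = ⊥-elim (right-only (appears C₁ σ') (appears C₂ σ') (higher∈Σ₂ σ σ' higher)
                               (anyFin-intro (λ i → alph (C₁ i) σ') j inAlph))

-- The runs of the composed system project to runs of both halves.
lemma3 : {n k₁ k₂ : ℕ} (C₁ : Fin k₁ → Component n) (C₂ : Fin k₂ → Component n)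
    (P₁ P₂ : Fin n → Fin n → Set) →
    let open Decomposition C₁ C₂ in
    (∀ σ → appears C₁ σ ∨ appears C₂ σ ≡ true) →
    (∀ σ σ' → P₁ σ σ' → inΣ₁ σ' ≡ true) →
    (∀ σ σ' → P₂ σ σ' → inΣ₂ σ' ≡ true) →
    (w : List (Fin n)) → Lang (S₁₊₂ P₁ P₂) w → Lang (S₁ P₁) w × Lang (S₂ P₂) w
lemma3 C₁ C₂ P₁ P₂ _ higher∈Σ₁ higher∈Σ₂ w run =
    projection (projection₁ P₁ P₂ higher∈Σ₁) w run
  , projection (projection₂ P₁ P₂ higher∈Σ₂) w run
  where open Halves C₁ C₂
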